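{- Let $\mathbf A$ be a structure with one symmetric ternary relation. If $f,g\colon\mathbf A\to\mathbf{LO}_4$ are two homomorphisms that differ in exactly one value, i.e. there is $d\in A$ such that $f(a)=g(a)$ for all $a\in A\setminus\{d\}$, then $f$ and $g$ are reconfigurable, i.e. $f$ and $g$ are connected by a path in (the geometric realization of) the homomorphism complex $\mathrm{Hom}(\mathbf A,\mathbf{LO}_4)$.
   Context: $\mathbf{LO}_4$ has domain $\{1,2,3,4\}$ and one ternary relation consisting of all triples with a unique maximum entry. A relation is symmetric if invariant under permuting coordinates. A multihomomorphism $\mathbf A\to\mathbf B$ is a map $m\colon A\to 2^B\setminus\{\emptyset\}$ such that $m(u_1)\times m(u_2)\times m(u_3)\subseteq R^{\mathbf B}$ for every $(u_1,u_2,u_3)\in R^{\mathbf A}$; multihomomorphisms are partially ordered by $m\le m'$ iff $m(u)\subseteq m'(u)$ for all $u$. The homomorphism complex $\mathrm{Hom}(\mathbf A,\mathbf B)$ is the order complex of this poset (simplices are chains); every homomorphism $h$ is a vertex (as $u\mapsto\{h(u)\}$). -}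

module Defs where

open import Level using (Level; suc; _⊔_)
open import Data.Nat using (ℕ)
open import Data.Fin using (Fin; _<_)
open import Data.Fin.Subset using (Subset; _∈_; _⊆_; ⁅_⁆; Nonempty)
open import Data.Product using (Σ; _×_; _,_; proj₁)
open import Data.Sum using (_⊎_)
open import Relation.Binary.Construct.Closure.ReflexiveTransitive using (Star)

record Ternary (ℓ : Level) : Set (suc ℓ) where
  field
    size : ℕ
    R    : Fin size → Fin size → Fin size → Set ℓ
open Ternary public

-- The relation is symmetric: invariant under all permutations of coordinates
-- (generated by the swaps (12) and (23)).
Symmetric : ∀ {ℓ} → Ternary ℓ → Set ℓ
Symmetric 𝐀 =
  (∀ x y z → R 𝐀 x y z → R 𝐀 y x z) ×
  (∀ x y z → R 𝐀 x y z → R 𝐀 x z y)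

-- LO_4: domain {1,2,3,4} (represented by Fin 4), relation: triples with a
-- unique maximum entry.
LO4 : Fin 4 → Fin 4 → Fin 4 → Set
LO4 x y z = (y < x × z < x) ⊎ (x < y × z < y) ⊎ (x < z × y < z)

IsHom : ∀ {ℓ} (𝐀 : Ternary ℓ) → (Fin (size 𝐀) → Fin 4) → Set ℓ
IsHom 𝐀 h = ∀ u₁ u₂ u₃ → R 𝐀 u₁ u₂ u₃ → LO4 (h u₁) (h u₂) (h u₃)

IsMultiHom : ∀ {ℓ} (𝐀 : Ternary ℓ) → (Fin (size 𝐀) → Subset 4) → Set ℓ
IsMultiHom 𝐀 m =
  (∀ u → Nonempty (m u)) ×
  (∀ u₁ u₂ u₃ → R 𝐀 u₁ u₂ u₃ →
     ∀ b₁ b₂ b₃ → b₁ ∈ m u₁ → b₂ ∈ m u₂ → b₃ ∈ m u₃ → LO4 b₁ b₂ b₃)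

MultiHom : ∀ {ℓ} → Ternary ℓ → Set ℓ
MultiHom 𝐀 = Σ (Fin (size 𝐀) → Subset 4) (IsMultiHom 𝐀)

_≼_ : ∀ {ℓ} {𝐀 : Ternary ℓ} → MultiHom 𝐀 → MultiHom 𝐀 → Set
m ≼ m' = ∀ u → proj₁ m u ⊆ proj₁ m' u

-- Edges of Hom(A, LO_4) = order complex of the poset: comparable pairs.
Comparable : ∀ {ℓ} {𝐀 : Ternary ℓ} → MultiHom 𝐀 → MultiHom 𝐀 → Set
Comparable m m' = m ≼ m' ⊎ m' ≼ m

vertex : ∀ {ℓ} (𝐀 : Ternary ℓ) (h : Fin (size 𝐀) → Fin 4) → IsHom 𝐀 h → MultiHom 𝐀
vertex 𝐀 h hh = (λ u → ⁅ h u ⁆) , (λ u → h u , x∈⁅x⁆ (h u)) ,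
  λ u₁ u₂ u₃ r b₁ b₂ b₃ p₁ p₂ p₃ →
    subst3 (x∈⁅y⁆⇒x≡y (h u₁) p₁) (x∈⁅y⁆⇒x≡y (h u₂) p₂) (x∈⁅y⁆⇒x≡y (h u₃) p₃) (hh u₁ u₂ u₃ r)
  where
  open import Data.Fin.Subset.Properties using (x∈⁅x⁆; x∈⁅y⁆⇒x≡y)
  open import Relation.Binary.PropositionalEquality using (_≡_; refl)
  subst3 : ∀ {a b c a' b' c'} → a' ≡ a → b' ≡ b → c' ≡ c → LO4 a b c → LO4 a' b' c'
  subst3 refl refl refl x = x

-- Two vertices lie in the same path component of (the geometric realisation
-- of) the order complex iff they are joined by a path in its 1-skeleton,
-- i.e. a finite sequence of multihomomorphisms, consecutive ones comparable.
Reconfigurable : ∀ {ℓ} (𝐀 : Ternary ℓ) → MultiHom 𝐀 → MultiHom 𝐀 → Set ℓ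
Reconfigurable 𝐀 = Star (Comparable {𝐀 = 𝐀})

{-# OPTIONS --safe #-}
-- The pointwise union m u = {f u, g u} is a multihomomorphism lying above both
-- f and g, so f ≼ m ≽ g is a path. A triple of A containing d at most once only
-- ever sees values of f, or only values of g. A triple containing d twice, say
-- (d, d, v), forces f d < f v and g d < g v = f v, so any two choices from m d
-- stay below the value at v. No triple contains d three times, since LO4 has
-- no constant triples.
module Submission where

open import Defs
open import Data.Fin using (Fin; _<_; _≟_)
open import Data.Fin.Subset using (Subset; _∈_; _∪_; ⁅_⁆)
open import Data.Fin.Subset.Properties using (x∈⁅x⁆; x∈⁅y⁆⇒x≡y; x∈p∪q⁻; x∈p∪q⁺)
open import Data.Fin.Properties using (<-irrefl)
open import Data.Product using (Σ; _,_)
open import Data.Sum using (inj₁; inj₂)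
open import Data.Empty using (⊥-elim)
open import Relation.Nullary using (¬_; yes; no)
open import Relation.Binary.PropositionalEquality using (_≡_; _≢_; refl; sym; subst)
open import Relation.Binary.Construct.Closure.ReflexiveTransitive using (ε; _◅_)

LO4-swap₁₂ : ∀ {x y z} → LO4 x y z → LO4 y x z
LO4-swap₁₂ (inj₁ (y<x , z<x))        = inj₂ (inj₁ (y<x , z<x))
LO4-swap₁₂ (inj₂ (inj₁ (x<y , z<y))) = inj₁ (x<y , z<y)
LO4-swap₁₂ (inj₂ (inj₂ (x<z , y<z))) = inj₂ (inj₂ (y<z , x<z))

LO4-swap₂₃ : ∀ {x y z} → LO4 x y z → LO4 x z y
LO4-swap₂₃ (inj₁ (y<x , z<x))        = inj₁ (z<x , y<x)
LO4-swap₂₃ (inj₂ (inj₁ (x<y , z<y))) = inj₂ (inj₂ (x<y , z<y))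
LO4-swap₂₃ (inj₂ (inj₂ (x<z , y<z))) = inj₂ (inj₁ (x<z , y<z))

LO4-xxz⇒x<z : ∀ {x z} → LO4 x x z → x < z
LO4-xxz⇒x<z (inj₁ (x<x , _))        = ⊥-elim (<-irrefl refl x<x)
LO4-xxz⇒x<z (inj₂ (inj₁ (x<x , _))) = ⊥-elim (<-irrefl refl x<x)
LO4-xxz⇒x<z (inj₂ (inj₂ (x<z , _))) = x<z

LO4-xzx⇒x<z : ∀ {x z} → LO4 x z x → x < z
LO4-xzx⇒x<z r = LO4-xxz⇒x<z (LO4-swap₂₃ r)

LO4-zxx⇒x<z : ∀ {x z} → LO4 z x x → x < z
LO4-zxx⇒x<z r = LO4-xzx⇒x<z (LO4-swap₁₂ r)

LO4-irreflexive : ∀ {x} → ¬ LO4 x x x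
LO4-irreflexive r = <-irrefl refl (LO4-xxz⇒x<z r)

common-upper-bound⇒Reconfigurable : ∀ {ℓ} {𝐀 : Ternary ℓ} {m m' M : MultiHom 𝐀} →
  m ≼ M → m' ≼ M → Reconfigurable 𝐀 m m'
common-upper-bound⇒Reconfigurable {M = M} m≼M m'≼M = _◅_ {j = M} (inj₁ m≼M) (inj₂ m'≼M ◅ ε)

module OnePointChange {ℓ} (𝐀 : Ternary ℓ)
  (f g : Fin (size 𝐀) → Fin 4) (hf : IsHom 𝐀 f) (hg : IsHom 𝐀 g)
  (d : Fin (size 𝐀)) (f≡g : ∀ a → a ≢ d → f a ≡ g a) where

  union : Fin (size 𝐀) → Subset 4
  union u = ⁅ f u ⁆ ∪ ⁅ g u ⁆

  data ValueAtD : Fin 4 → Set where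
    f-value : ValueAtD (f d)
    g-value : ValueAtD (g d)

  data Cell : Fin (size 𝐀) → Fin 4 → Set where
    at-d : ∀ {b} → ValueAtD b → Cell d b
    away : ∀ {u} → u ≢ d → Cell u (f u)

  cell : ∀ {u b} → b ∈ union u → Cell u b
  cell {u} b∈ with u ≟ d | x∈p∪q⁻ ⁅ f u ⁆ ⁅ g u ⁆ b∈
  ... | yes refl | inj₁ b∈⁅fd⁆ rewrite x∈⁅y⁆⇒x≡y (f d) b∈⁅fd⁆ = at-d f-value
  ... | yes refl | inj₂ b∈⁅gd⁆ rewrite x∈⁅y⁆⇒x≡y (g d) b∈⁅gd⁆ = at-d g-value
  ... | no u≢d   | inj₁ b∈⁅fu⁆ rewrite x∈⁅y⁆⇒x≡y (f u) b∈⁅fu⁆ = away u≢d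
  ... | no u≢d   | inj₂ b∈⁅gu⁆ rewrite x∈⁅y⁆⇒x≡y (g u) b∈⁅gu⁆ | sym (f≡g u u≢d) = away u≢d

  ValueAtD-below : ∀ {b v} → ValueAtD b → v ≢ d → f d < f v → g d < g v → b < f v
  ValueAtD-below f-value _   fd<fv _     = fd<fv
  ValueAtD-below g-value v≢d _     gd<gv = subst (g d <_) (sym (f≡g _ v≢d)) gd<gv

  LO4-cells : ∀ {u₁ u₂ u₃ b₁ b₂ b₃} → R 𝐀 u₁ u₂ u₃ →
    Cell u₁ b₁ → Cell u₂ b₂ → Cell u₃ b₃ → LO4 b₁ b₂ b₃
  LO4-cells r (away _)       (away _)       (away _)       = hf _ _ _ r
  LO4-cells r (at-d f-value) (away _)       (away _)       = hf _ _ _ r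
  LO4-cells r (away _)       (at-d f-value) (away _)       = hf _ _ _ r
  LO4-cells r (away _)       (away _)       (at-d f-value) = hf _ _ _ r
  LO4-cells r (at-d g-value) (away n₂)      (away n₃)
    rewrite f≡g _ n₂ | f≡g _ n₃ = hg _ _ _ r
  LO4-cells r (away n₁)      (at-d g-value) (away n₃)
    rewrite f≡g _ n₁ | f≡g _ n₃ = hg _ _ _ r
  LO4-cells r (away n₁)      (away n₂)      (at-d g-value)
    rewrite f≡g _ n₁ | f≡g _ n₂ = hg _ _ _ r
  LO4-cells r (at-d x) (at-d y) (away n) = inj₂ (inj₂ (below x , below y))
    where
    below : ∀ {b} → ValueAtD b → b < _
    below z = ValueAtD-below z n (LO4-xxz⇒x<z (hf _ _ _ r)) (LO4-xxz⇒x<z (hg _ _ _ r))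
  LO4-cells r (at-d x) (away n) (at-d z) = inj₂ (inj₁ (below x , below z))
    where
    below : ∀ {b} → ValueAtD b → b < _
    below y = ValueAtD-below y n (LO4-xzx⇒x<z (hf _ _ _ r)) (LO4-xzx⇒x<z (hg _ _ _ r))
  LO4-cells r (away n) (at-d y) (at-d z) = inj₁ (below y , below z)
    where
    below : ∀ {b} → ValueAtD b → b < _
    below x = ValueAtD-below x n (LO4-zxx⇒x<z (hf _ _ _ r)) (LO4-zxx⇒x<z (hg _ _ _ r))
  LO4-cells r (at-d _) (at-d _) (at-d _) = ⊥-elim (LO4-irreflexive (hf _ _ _ r))

  union-isMultiHom : IsMultiHom 𝐀 union
  union-isMultiHom =
    (λ u → f u , x∈p∪q⁺ (inj₁ (x∈⁅x⁆ (f u)))) ,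
    λ _ _ _ r _ _ _ b₁∈ b₂∈ b₃∈ → LO4-cells r (cell b₁∈) (cell b₂∈) (cell b₃∈)

  reconfigurable : Reconfigurable 𝐀 (vertex 𝐀 f hf) (vertex 𝐀 g hg)
  reconfigurable = common-upper-bound⇒Reconfigurable {M = union , union-isMultiHom}
    (λ _ b∈ → x∈p∪q⁺ (inj₁ b∈)) (λ _ b∈ → x∈p∪q⁺ (inj₂ b∈))

lemma4p1 : ∀ {ℓ} (𝐀 : Ternary ℓ) → Symmetric 𝐀 →
    (f g : Fin (size 𝐀) → Fin 4) (hf : IsHom 𝐀 f) (hg : IsHom 𝐀 g) →
    Σ (Fin (size 𝐀)) (λ d → ∀ a → a ≢ d → f a ≡ g a) →
    Reconfigurable 𝐀 (vertex 𝐀 f hf) (vertex 𝐀 g hg)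
lemma4p1 𝐀 _ f g hf hg (d , f≡g) = OnePointChange.reconfigurable 𝐀 f g hf hg d f≡g
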